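{- The following equations (with variables $x,y$) are derivable in equational logic from $\mathrm{EqFFEL}^{\mathsf U}$: 1. $x\mathbin{\vee_\bullet}(y\mathbin{\wedge_\bullet}\mathsf U)=(x\mathbin{\vee_\bullet}y)\mathbin{\wedge_\bullet}\mathsf U$; 2. $x\mathbin{\vee_\bullet}(y\mathbin{\wedge_\bullet}\mathsf U)=x\mathbin{\wedge_\bullet}(y\mathbin{\wedge_\bullet}\mathsf U)$; 3. $\neg x\mathbin{\wedge_\bullet}(y\mathbin{\wedge_\bullet}\mathsf U)=x\mathbin{\wedge_\bullet}(y\mathbin{\wedge_\bullet}\mathsf U)$.
   Context: Terms are built from variables, constants $\mathsf T,\mathsf F,\mathsf U$, atoms, unary $\neg$ and binary $\mathbin{\wedge_\bullet},\mathbin{\vee_\bullet}$. $\mathrm{EqFFEL}^{\mathsf U}$ consists of the equations: $\mathsf F=\neg\mathsf T$; $x\mathbin{\vee_\bullet}y=\neg(\neg x\mathbin{\wedge_\bullet}\neg y)$; $\neg\neg x=x$; $(x\mathbin{\wedge_\bullet}y)\mathbin{\wedge_\bullet}z=x\mathbin{\wedge_\bullet}(y\mathbin{\wedge_\bullet}z)$; $\mathsf T\mathbin{\wedge_\bullet}x=x$; $x\mathbin{\wedge_\bullet}\mathsf T=x$; $x\mathbin{\wedge_\bullet}\mathsf F=\mathsf F\mathbin{\wedge_\bullet}x$; $\neg x\mathbin{\wedge_\bullet}\mathsf F=x\mathbin{\wedge_\bullet}\mathsf F$; $(x\mathbin{\wedge_\bullet}\mathsf F)\mathbin{\vee_\bullet}y=(x\mathbin{\vee_\bullet}\mathsf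 T)\mathbin{\wedge_\bullet}y$; $x\mathbin{\vee_\bullet}(y\mathbin{\wedge_\bullet}\mathsf F)=x\mathbin{\wedge_\bullet}(y\mathbin{\vee_\bullet}\mathsf T)$; $\neg\mathsf U=\mathsf U$; $\mathsf U\mathbin{\wedge_\bullet}x=\mathsf U$. -}

module Defs where

open import Data.Nat using (ℕ)

data Term (A : Set) : Set where
  var  : ℕ → Term A
  atom : A → Term A
  T F U : Term A
  ¬_   : Term A → Term A
  _∧●_ : Term A → Term A → Term A
  _∨●_ : Term A → Term A → Term A

infix  8 ¬_
infixr 6 _∧●_
infixr 5 _∨●_

subst : {A : Set} → (ℕ → Term A) → Term A → Term A
subst σ (var n)   = σ n
subst σ (atom a)  = atom a
subst σ T         = T
subst σ F         = F
subst σ U         = U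
subst σ (¬ t)     = ¬ subst σ t
subst σ (t ∧● s)  = subst σ t ∧● subst σ s
subst σ (t ∨● s)  = subst σ t ∨● subst σ s

x y z : {A : Set} → Term A
x = var 0
y = var 1
z = var 2

data Axiom {A : Set} : Term A → Term A → Set where
  ax-F     : Axiom F (¬ T)
  ax-or    : Axiom (x ∨● y) (¬ ((¬ x) ∧● (¬ y)))
  ax-neg   : Axiom (¬ ¬ x) x
  ax-assoc : Axiom ((x ∧● y) ∧● z) (x ∧● (y ∧● z))
  ax-Tl    : Axiom (T ∧● x) x
  ax-Tr    : Axiom (x ∧● T) x
  ax-Fcomm : Axiom (x ∧● F) (F ∧● x)
  ax-negF  : Axiom ((¬ x) ∧● F) (x ∧● F)
  ax-Fl    : Axiom ((x ∧● F) ∨● y) ((x ∨● T) ∧● y)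
  ax-Fr    : Axiom (x ∨● (y ∧● F)) (x ∧● (y ∨● T))
  ax-negU  : Axiom (¬ U) U
  ax-U     : Axiom (U ∧● x) U

infix 4 _⊢≈_
data _⊢≈_ {A : Set} : Term A → Term A → Set where
  axiom : ∀ {l r} (σ : ℕ → Term A) → Axiom l r → subst σ l ⊢≈ subst σ r
  refl  : ∀ {t} → t ⊢≈ t
  sym   : ∀ {t s} → t ⊢≈ s → s ⊢≈ t
  trans : ∀ {t s u} → t ⊢≈ s → s ⊢≈ u → t ⊢≈ u
  cong¬ : ∀ {t s} → t ⊢≈ s → ¬ t ⊢≈ ¬ s
  cong∧ : ∀ {t t' s s'} → t ⊢≈ t' → s ⊢≈ s' → t ∧● s ⊢≈ t' ∧● s'
  cong∨ : ∀ {t t' s s'} → t ⊢≈ t' → s ⊢≈ s' → t ∨● s ⊢≈ t' ∨● s'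

-- A term u is absorbing if u ∧● a ≈ u for every a; U is, and so is every b ∧● U.
-- Absorbing terms satisfy u ≈ u ∧● F, so the two F-axioms turn a disjunction with u
-- into a conjunction with ¬ u; comparing two such rewritings of ¬ u ∧● U shows ¬ u ≈ u.
-- Since F ∧● u ≈ u, negation can also be pushed through the F-axiom for ¬ x ∧● F.
module Submission where

open import Defs
open import Data.Nat using (ℕ; zero; suc)
open import Data.Product using (_×_; _,_)
open import Relation.Binary.Bundles using (Setoid)
open import Relation.Binary.Structures using (IsEquivalence)
import Relation.Binary.Reasoning.Setoid as SetoidReasoning

module _ {A : Set} where

  ⊢≈-isEquivalence : IsEquivalence (_⊢≈_ {A})
  ⊢≈-isEquivalence = record { refl = refl ; sym = sym ; trans = trans }

  ⊢≈-setoid : Setoid _ _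
  ⊢≈-setoid = record { Carrier = Term A ; _≈_ = _⊢≈_ ; isEquivalence = ⊢≈-isEquivalence }

  open SetoidReasoning ⊢≈-setoid

  ⟨_,_,_⟩ : Term A → Term A → Term A → ℕ → Term A
  ⟨ a , b , c ⟩ zero          = a
  ⟨ a , b , c ⟩ (suc zero)    = b
  ⟨ a , b , c ⟩ (suc (suc _)) = c

  F-def : F ⊢≈ ¬ T
  F-def = axiom ⟨ T , T , T ⟩ ax-F

  ∨-def : ∀ a b → a ∨● b ⊢≈ ¬ (¬ a ∧● ¬ b)
  ∨-def a b = axiom ⟨ a , b , a ⟩ ax-or

  ∧-assoc : ∀ a b c → (a ∧● b) ∧● c ⊢≈ a ∧● (b ∧● c)
  ∧-assoc a b c = axiom ⟨ a , b , c ⟩ ax-assoc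

  ∧F-comm : ∀ a → a ∧● F ⊢≈ F ∧● a
  ∧F-comm a = axiom ⟨ a , a , a ⟩ ax-Fcomm

  ¬-∧F : ∀ a → ¬ a ∧● F ⊢≈ a ∧● F
  ¬-∧F a = axiom ⟨ a , a , a ⟩ ax-negF

  ∧F-∨ : ∀ a b → (a ∧● F) ∨● b ⊢≈ (a ∨● T) ∧● b
  ∧F-∨ a b = axiom ⟨ a , b , a ⟩ ax-Fl

  ∨-∧F : ∀ a b → a ∨● (b ∧● F) ⊢≈ a ∧● (b ∨● T)
  ∨-∧F a b = axiom ⟨ a , b , a ⟩ ax-Fr

  ¬U : ¬ U ⊢≈ U
  ¬U = axiom ⟨ T , T , T ⟩ ax-negU

  Absorbing : Term A → Set
  Absorbing u = ∀ a → u ∧● a ⊢≈ u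

  U-absorbing : Absorbing U
  U-absorbing a = axiom ⟨ a , a , a ⟩ ax-U

  ∧-absorbing : ∀ b {u} → Absorbing u → Absorbing (b ∧● u)
  ∧-absorbing b {u} u-abs a = trans (∧-assoc b u a) (cong∧ refl (u-abs a))

  module _ {u : Term A} (u-abs : Absorbing u) where

    absorbing-∨T : u ∨● T ⊢≈ ¬ u
    absorbing-∨T = begin
      u ∨● T          ≈⟨ ∨-def u T ⟩
      ¬ (¬ u ∧● ¬ T)  ≈⟨ cong¬ (cong∧ refl F-def) ⟨
      ¬ (¬ u ∧● F)    ≈⟨ cong¬ (¬-∧F u) ⟩
      ¬ (u ∧● F)      ≈⟨ cong¬ (u-abs F) ⟩
      ¬ u             ∎

    ∨-absorbingʳ : ∀ a → a ∨● u ⊢≈ a ∧● ¬ u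
    ∨-absorbingʳ a = begin
      a ∨● u         ≈⟨ cong∨ refl (u-abs F) ⟨
      a ∨● (u ∧● F)  ≈⟨ ∨-∧F a u ⟩
      a ∧● (u ∨● T)  ≈⟨ cong∧ refl absorbing-∨T ⟩
      a ∧● ¬ u       ∎

    ∨-absorbingˡ : ∀ a → u ∨● a ⊢≈ ¬ u ∧● a
    ∨-absorbingˡ a = begin
      u ∨● a         ≈⟨ cong∨ (u-abs F) refl ⟨
      (u ∧● F) ∨● a  ≈⟨ ∧F-∨ u a ⟩
      (u ∨● T) ∧● a  ≈⟨ cong∧ absorbing-∨T refl ⟩
      ¬ u ∧● a       ∎

    F-∧-absorbing : F ∧● u ⊢≈ u
    F-∧-absorbing = trans (sym (∧F-comm u)) (u-abs F)

    ¬-∧-absorbing : ∀ a → ¬ a ∧● u ⊢≈ a ∧● u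
    ¬-∧-absorbing a = begin
      ¬ a ∧● u          ≈⟨ cong∧ refl F-∧-absorbing ⟨
      ¬ a ∧● (F ∧● u)   ≈⟨ ∧-assoc (¬ a) F u ⟨
      (¬ a ∧● F) ∧● u   ≈⟨ cong∧ (¬-∧F a) refl ⟩
      (a ∧● F) ∧● u     ≈⟨ ∧-assoc a F u ⟩
      a ∧● (F ∧● u)     ≈⟨ cong∧ refl F-∧-absorbing ⟩
      a ∧● u            ∎

  ¬-absorbing : ∀ {u} → Absorbing u → ¬ u ⊢≈ u
  ¬-absorbing {u} u-abs = begin
    ¬ u               ≈⟨ cong¬ ¬u∧U≈u ⟨
    ¬ (¬ u ∧● U)      ≈⟨ cong¬ (cong∧ refl ¬U) ⟨
    ¬ (¬ u ∧● ¬ U)    ≈⟨ ∨-def u U ⟨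
    u ∨● U            ≈⟨ ∨-absorbingˡ u-abs U ⟩
    ¬ u ∧● U          ≈⟨ ¬u∧U≈u ⟩
    u                 ∎
    where
    ¬u∧U≈u : ¬ u ∧● U ⊢≈ u
    ¬u∧U≈u = begin
      ¬ u ∧● U  ≈⟨ ∨-absorbingˡ u-abs U ⟨
      u ∨● U    ≈⟨ ∨-absorbingʳ U-absorbing u ⟩
      u ∧● ¬ U  ≈⟨ u-abs (¬ U) ⟩
      u         ∎

  ∨-∧U : ∀ a b → a ∨● (b ∧● U) ⊢≈ a ∧● (b ∧● U)
  ∨-∧U a b = begin
    a ∨● (b ∧● U)     ≈⟨ ∨-absorbingʳ bU-abs a ⟩
    a ∧● ¬ (b ∧● U)   ≈⟨ cong∧ refl (¬-absorbing bU-abs) ⟩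
    a ∧● (b ∧● U)     ∎
    where
    bU-abs : Absorbing (b ∧● U)
    bU-abs = ∧-absorbing b U-absorbing

  ¬-∧-∧U : ∀ a b → ¬ a ∧● (b ∧● U) ⊢≈ a ∧● (b ∧● U)
  ¬-∧-∧U a b = ¬-∧-absorbing (∧-absorbing b U-absorbing) a

  ∨-∧U-distrib : ∀ a b → (a ∨● b) ∧● U ⊢≈ a ∧● (b ∧● U)
  ∨-∧U-distrib a b = begin
    (a ∨● b) ∧● U          ≈⟨ cong∧ (∨-def a b) refl ⟩
    ¬ (¬ a ∧● ¬ b) ∧● U    ≈⟨ ¬-∧-absorbing U-absorbing (¬ a ∧● ¬ b) ⟩
    (¬ a ∧● ¬ b) ∧● U      ≈⟨ ∧-assoc (¬ a) (¬ b) U ⟩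
    ¬ a ∧● (¬ b ∧● U)      ≈⟨ ¬-∧-∧U a (¬ b) ⟩
    a ∧● (¬ b ∧● U)        ≈⟨ cong∧ refl (¬-∧-absorbing U-absorbing b) ⟩
    a ∧● (b ∧● U)          ∎

lemma3p7 : (A : Set) →
    (_⊢≈_ {A} (x ∨● (y ∧● U)) ((x ∨● y) ∧● U))
    × (_⊢≈_ {A} (x ∨● (y ∧● U)) (x ∧● (y ∧● U)))
    × (_⊢≈_ {A} ((¬ x) ∧● (y ∧● U)) (x ∧● (y ∧● U)))
lemma3p7 A = trans (∨-∧U x y) (sym (∨-∧U-distrib x y)) , ∨-∧U x y , ¬-∧-∧U x y
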